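{- Let $k\ge0$ be an integer and let $U$, $V$ be sets. For a set $X$ let $c:X^k\to\mathcal M_f^k(X)=X^k/\mathfrak S_k$ be the quotient map onto orbits under permutation of coordinates. Suppose $h:U^k\to U^k$ sends every element of $U^k$ to a permutation of itself, i.e., $c\,h=c$. Then for any function $f:V\to U$ there is a function $\rho:V^k\to V^k$ with $c\,\rho=c$ such that $h\,f^k=f^k\,\rho$ and the square $$\begin{array}{ccc}V^k&\xrightarrow{f^k}&U^k\\ {\scriptstyle\rho}\downarrow&&\downarrow{\scriptstyle h}\\ V^k&\xrightarrow{f^k}&U^k\end{array}$$ is a pullback in $\mathbf{Set}$.
   Context: $f^k:V^k\to U^k$ denotes $f$ applied coordinatewise; $\mathfrak S_k$ is the symmetric group on $\{1,\dots,k\}$ acting on $k$-tuples by permuting coordinates. -}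

module Defs where

open import Data.Nat using (ℕ)
open import Data.Vec using (Vec; tabulate; lookup; map)
open import Data.Fin.Permutation using (Permutation′; _⟨$⟩ʳ_)
open import Data.Product using (Σ; _×_; ∃)
open import Relation.Binary.PropositionalEquality using (_≡_)

permute : {X : Set} {k : ℕ} → Permutation′ k → Vec X k → Vec X k
permute σ x = tabulate (λ i → lookup x (σ ⟨$⟩ʳ i))

-- c x ≡ c y in M_f^k(X) = X^k / 𝔖_k, i.e. x and y lie in the same orbit.
SameOrbit : {X : Set} {k : ℕ} → Vec X k → Vec X k → Set
SameOrbit {k = k} x y = ∃ λ (σ : Permutation′ k) → y ≡ permute σ x

PreservesOrbits : {X : Set} {k : ℕ} → (Vec X k → Vec X k) → Set
PreservesOrbits {X} {k} g = (x : Vec X k) → SameOrbit x (g x)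

_^^_ : {V U : Set} → (V → U) → (k : ℕ) → Vec V k → Vec U k
(f ^^ k) = map f

IsPullback : {A B C D : Set} → (top : A → B) → (left : A → C)
  → (right : B → D) → (bot : C → D) → Set
IsPullback {A} {B} {C} top left right bot =
  ((a : A) → right (top a) ≡ bot (left a))
  × ((x : C) (y : B) → bot x ≡ right y →
       Σ A (λ a → (left a ≡ x × top a ≡ y)
                × ((a′ : A) → left a′ ≡ x → top a′ ≡ y → a′ ≡ a)))

module Submission where

-- A map h : U^k → U^k with c h = c is, pointwise, a permutation of
-- coordinates: choose for each y a permutation σ y with h y = σ y · y.
-- Lift h along f^k by letting each v ∈ V^k be permuted by the permutation
-- chosen for its image:  ρ v = σ (f^k v) · v.  Since f^k commutes with
-- permuting coordinates, h f^k = f^k ρ.  The square is a pullback because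
-- ρ is invertible on each fibre of f^k over a fixed y: the unique a with
-- f^k a = y and ρ a = x is a = (σ y)⁻¹ · x.

open import Defs
open import Data.Nat using (ℕ)
open import Data.Fin using (Fin)
open import Data.Vec using (Vec; tabulate; lookup; map)
open import Data.Vec.Properties using (lookup∘tabulate; tabulate∘lookup; tabulate-cong; lookup-map)
open import Data.Fin.Permutation using (Permutation′; _⟨$⟩ʳ_; flip; inverseˡ; inverseʳ)
open import Data.Product using (Σ; _×_; _,_; proj₁; proj₂)
open import Relation.Binary.PropositionalEquality using (_≡_; refl; sym; trans; cong; module ≡-Reasoning)

module _ {X : Set} {k : ℕ} where

  lookup-permute : (σ : Permutation′ k) (x : Vec X k) (i : Fin k) →
    lookup (permute σ x) i ≡ lookup x (σ ⟨$⟩ʳ i)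
  lookup-permute σ x i = lookup∘tabulate (λ j → lookup x (σ ⟨$⟩ʳ j)) i

  permute-flip-permute : (σ : Permutation′ k) (x : Vec X k) →
    permute (flip σ) (permute σ x) ≡ x
  permute-flip-permute σ x = begin
    tabulate (λ i → lookup (permute σ x) (flip σ ⟨$⟩ʳ i))
      ≡⟨ tabulate-cong (λ i → lookup-permute σ x (flip σ ⟨$⟩ʳ i)) ⟩
    tabulate (λ i → lookup x (σ ⟨$⟩ʳ (flip σ ⟨$⟩ʳ i)))
      ≡⟨ tabulate-cong (λ i → cong (lookup x) (inverseʳ σ)) ⟩
    tabulate (lookup x)
      ≡⟨ tabulate∘lookup x ⟩
    x ∎
    where open ≡-Reasoning

  permute-permute-flip : (σ : Permutation′ k) (x : Vec X k) →
    permute σ (permute (flip σ) x) ≡ x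
  permute-permute-flip σ x = begin
    tabulate (λ i → lookup (permute (flip σ) x) (σ ⟨$⟩ʳ i))
      ≡⟨ tabulate-cong (λ i → lookup-permute (flip σ) x (σ ⟨$⟩ʳ i)) ⟩
    tabulate (λ i → lookup x (flip σ ⟨$⟩ʳ (σ ⟨$⟩ʳ i)))
      ≡⟨ tabulate-cong (λ i → cong (lookup x) (inverseˡ σ)) ⟩
    tabulate (lookup x)
      ≡⟨ tabulate∘lookup x ⟩
    x ∎
    where open ≡-Reasoning

map-permute : {A B : Set} {k : ℕ} (f : A → B) (σ : Permutation′ k) (x : Vec A k) →
  map f (permute σ x) ≡ permute σ (map f x)
map-permute f σ x = begin
  map f (permute σ x)
    ≡⟨ sym (tabulate∘lookup _) ⟩
  tabulate (λ i → lookup (map f (permute σ x)) i)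
    ≡⟨ tabulate-cong (λ i → lookup-map i f (permute σ x)) ⟩
  tabulate (λ i → f (lookup (permute σ x) i))
    ≡⟨ tabulate-cong (λ i → cong f (lookup-permute σ x i)) ⟩
  tabulate (λ i → f (lookup x (σ ⟨$⟩ʳ i)))
    ≡⟨ tabulate-cong (λ i → sym (lookup-map (σ ⟨$⟩ʳ i) f x)) ⟩
  permute σ (map f x) ∎
  where open ≡-Reasoning

module Lift {U V : Set} {k : ℕ} (f : V → U) (σ : Vec U k → Permutation′ k)
            (h : Vec U k → Vec U k) (h-σ : (y : Vec U k) → h y ≡ permute (σ y) y) where

  ρ : Vec V k → Vec V k
  ρ v = permute (σ (map f v)) v

  ρ-preserves-orbits : PreservesOrbits ρ
  ρ-preserves-orbits v = σ (map f v) , refl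

  ρ-commutes : (v : Vec V k) → h (map f v) ≡ map f (ρ v)
  ρ-commutes v = trans (h-σ (map f v)) (sym (map-permute f (σ (map f v)) v))

  -- Over a fixed y ∈ U^k, ρ acts on the fibre of f^k as the single
  -- permutation σ y, so a = (σ y)⁻¹ · x is the unique point with
  -- ρ a = x and f^k a = y whenever f^k x = h y.
  ρ-pullback : (x : Vec V k) (y : Vec U k) → map f x ≡ h y →
    Σ (Vec V k) (λ a → (ρ a ≡ x × map f a ≡ y)
      × ((a′ : Vec V k) → ρ a′ ≡ x → map f a′ ≡ y → a′ ≡ a))
  ρ-pullback x y fx≡hy = a , (ρa≡x , fa≡y) , unique
    where
    a : Vec V k
    a = permute (flip (σ y)) x

    fa≡y : map f a ≡ y
    fa≡y = begin
      map f (permute (flip (σ y)) x)   ≡⟨ map-permute f (flip (σ y)) x ⟩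
      permute (flip (σ y)) (map f x)   ≡⟨ cong (permute (flip (σ y))) (trans fx≡hy (h-σ y)) ⟩
      permute (flip (σ y)) (permute (σ y) y) ≡⟨ permute-flip-permute (σ y) y ⟩
      y ∎
      where open ≡-Reasoning

    ρa≡x : ρ a ≡ x
    ρa≡x = trans (cong (λ z → permute (σ z) a) fa≡y) (permute-permute-flip (σ y) x)

    unique : (a′ : Vec V k) → ρ a′ ≡ x → map f a′ ≡ y → a′ ≡ a
    unique a′ ρa′≡x fa′≡y = begin
      a′                                        ≡⟨ sym (permute-flip-permute (σ y) a′) ⟩
      permute (flip (σ y)) (permute (σ y) a′)   ≡⟨ cong (λ z → permute (flip (σ y)) (permute (σ z) a′)) (sym fa′≡y) ⟩
      permute (flip (σ y)) (ρ a′)               ≡⟨ cong (permute (flip (σ y))) ρa′≡x ⟩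
      a ∎
      where open ≡-Reasoning

lemma3p9 : (k : ℕ) (U V : Set) (h : Vec U k → Vec U k) → PreservesOrbits h
    → (f : V → U) → Σ (Vec V k → Vec V k) (λ ρ → PreservesOrbits ρ
        × ((v : Vec V k) → h ((f ^^ k) v) ≡ (f ^^ k) (ρ v))
        × IsPullback (f ^^ k) ρ h (f ^^ k))
lemma3p9 k U V h h-preserves f =
  ρ , ρ-preserves-orbits , ρ-commutes , ρ-commutes , ρ-pullback
  where
  open Lift f (λ y → proj₁ (h-preserves y)) h (λ y → proj₂ (h-preserves y))
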